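{- Let $p\neq q$ be primes, $k\ge1$ an integer, $e_i\in\{0,1\}$ arbitrary for $i\in\{1,\dots,k-1\}$, and $e_k=1$. Suppose that $\Phi_{pq}^{e_1}\Phi_{p^2q}^{e_2}\cdots\Phi_{p^kq}^{e_k}=\mathrm P_T$ for a numerical semigroup $T$. Then $e_i=1$ for all $1\le i\le k$ and $T=\langle p^k,q\rangle$.
   Context: A numerical semigroup $T$ is a submonoid of $(\mathbb N,+)$ with finite complement; $\mathrm P_T(x)=(1-x)\sum_{t\in T}x^t$ is its semigroup polynomial; $\langle a,b\rangle$ denotes the submonoid generated by $a,b$. $\Phi_n$ is the $n$-th cyclotomic polynomial. -}

module Defs where

open import Data.Bool using (Bool; true; false; if_then_else_; not; _∧_)
open import Data.Nat using (ℕ; zero; suc; _+_; _*_; _∸_; _≤_; _/_; _≡ᵇ_; _^_)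
open import Data.Nat.Divisibility using (_∣?_)
open import Data.Nat.Primality using (prime?)
open import Data.Integer as ℤ using (ℤ; +_; -[1+_])
open import Data.List using (List; upTo; map; filter; length; foldr)
open import Data.Product using (∃)
open import Relation.Nullary using (does)
open import Relation.Binary.PropositionalEquality using (_≡_)

PS : Set
PS = ℕ → ℤ

sumTo : (ℕ → ℤ) → ℕ → ℤ
sumTo h zero    = h 0
sumTo h (suc n) = sumTo h n ℤ.+ h (suc n)

_⊛_ : PS → PS → PS
(f ⊛ g) n = sumTo (λ i → f i ℤ.* g (n ∸ i)) n

oneS : PS
oneS zero    = + 1
oneS (suc _) = + 0

-- x^d - 1   (d ≥ 1)
xPowMinusOne : ℕ → PS
xPowMinusOne d n = if n ≡ᵇ 0 then -[1+ 0 ] else (if n ≡ᵇ d then + 1 else + 0)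

-- (x^d - 1)^{-1} = - Σ_j x^{d j}   (d ≥ 1)
xPowMinusOneInv : ℕ → PS
xPowMinusOneInv d n = if does (d ∣? n) then -[1+ 0 ] else + 0

squarefree : ℕ → Bool
squarefree n = foldr (λ i b → not (does (((2 + i) * (2 + i)) ∣? n)) ∧ b) true (upTo n)

numPrimeDivisors : ℕ → ℕ
numPrimeDivisors n = length (filter (λ d → prime? d) (filter (λ d → d ∣? n) (map suc (upTo n))))

möbius : ℕ → ℤ
möbius n = if squarefree n
             then (if does (2 ∣? numPrimeDivisors n) then + 1 else -[1+ 0 ])
             else + 0

-- (x^d - 1)^m for m ∈ {-1,0,1}
powFactor : ℕ → ℤ → PS
powFactor d (+ 1)      = xPowMinusOne d
powFactor d -[1+ 0 ]   = xPowMinusOneInv d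
powFactor d _          = oneS

-- n-th cyclotomic polynomial (n ≥ 1), via Φ_n = ∏_{d ∣ n} (x^d - 1)^{μ(n/d)}
cyclotomic : ℕ → PS
cyclotomic n = foldr step oneS (upTo n)
  where
  step : ℕ → PS → PS
  step i acc = if does (suc i ∣? n) then powFactor (suc i) (möbius (n / suc i)) ⊛ acc else acc

cycloProduct : ℕ → ℕ → (ℕ → Bool) → ℕ → PS
cycloProduct p q e k = foldr step oneS (upTo k)
  where
  step : ℕ → PS → PS
  step j acc = if e (suc j) then cyclotomic (p ^ suc j * q) ⊛ acc else acc

record NumericalSemigroup : Set where
  field
    mem        : ℕ → Bool
    mem-zero   : mem 0 ≡ true
    mem-closed : ∀ a b → mem a ≡ true → mem b ≡ true → mem (a + b) ≡ true
    cofinite   : ∃ λ F → ∀ n → F ≤ n → mem n ≡ true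
open NumericalSemigroup public

ind : Bool → ℤ
ind true  = + 1
ind false = + 0

-- P_T(x) = (1 - x) Σ_{t ∈ T} x^t
semigroupPoly : NumericalSemigroup → PS
semigroupPoly T zero    = ind (mem T 0)
semigroupPoly T (suc m) = ind (mem T (suc m)) ℤ.- ind (mem T m)

-- Write X d = x^d − 1. By Möbius inversion
-- Φ_{p^{i+1} q} = X(p^{i+1} q) X(p^i) / (X(p^{i+1}) X(p^i q)), so Φ_{pq} ⋯ Φ_{p^j q} telescopes to
-- X(1) X(p^j q) / (X(p^j) X(q)) = (1 − x) H_j, where H_j = (1 − x^{p^j q}) / ((1 − x^{p^j}) (1 − x^q))
-- is the Hilbert series Σ_{n ∈ ⟨p^j, q⟩} x^n.
--
-- Let j be least with e_{j+1} = 0 and suppose j < k. Dividing by 1 − x, the Hilbert series of T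
-- is H_j times the product of the remaining factors Φ_{p^{i+1} q}; as Φ_{p^{i+1} q} ≡ 1 − x^{p^i}
-- modulo x^{p^i + 1}, that product is 1 − x^N modulo x^{N + 1} for N = p^i the first remaining
-- exponent. Comparing coefficients, p^j ∈ T but its multiple N ∉ T, which is impossible.
-- Hence all e_i = 1, the Hilbert series of T is H_k, and T = ⟨p^k, q⟩.

{-# OPTIONS --safe #-}
module Submission where

open import Defs
open import Algebra.Bundles using (CommutativeMonoid)
import Algebra.Properties.CommutativeSemigroup as CommutativeSemigroupProperties
import Algebra.Solver.CommutativeMonoid as CommutativeMonoidSolver
open import Data.Bool using (Bool; true; false; if_then_else_; _∧_; _∨_; not)
open import Data.Bool.Properties using (∧-identityʳ; ∧-zeroʳ)
open import Data.Empty using (⊥; ⊥-elim)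
open import Data.Integer as ℤ using (ℤ; +_; -[1+_]; -_)
import Data.Integer.Properties as ℤ
open import Data.List using (foldr; filter; length; applyUpTo)
open import Data.List.Properties using (map-applyUpTo)
open import Data.Nat as ℕ
  using (ℕ; zero; suc; _+_; _*_; _∸_; _^_; _≤_; _<_; z≤n; s≤s; z<s; s<s; NonZero; >-nonZero⁻¹)
open import Data.Nat.Properties
open import Data.Nat.Coprimality using (Coprime; coprime-divisor)
open import Data.Nat.Primality
  using (Prime; prime?; euclidsLemma; prime⇒irreducible; prime⇒nonZero; prime⇒nonTrivial)
open import Data.Nat.DivMod using (_/_; _%_; m%n<n; m≡m%n+[m/n]*n; m*n/n≡m)
open import Data.Nat.Divisibility
  using (_∣_; _∣?_; divides; ∣-refl; ∣-trans; _∣0; ∣⇒≤; ∣1⇒≡1; ∣m∸n∣n⇒∣m; ∣m+n∣m⇒∣n; n∣m*n; m∣m*n;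
         *-cancelˡ-∣; *-cancelʳ-∣; *-pres-∣; ∣m⇒∣m*n)
open import Data.Product using (∃; ∃-syntax; _×_; _,_)
open import Data.Sum using (_⊎_; inj₁; inj₂)
open import Data.Unit using (⊤; tt)
open import Function using (_∘_; _⇔_; mk⇔)
open import Level using (0ℓ)
import Data.Nat.Solver as NatSolver
import Relation.Binary.Reasoning.Setoid as SetoidReasoning
open import Relation.Binary.PropositionalEquality
open import Relation.Nullary using (¬_; yes; no; does; Dec; contradiction; _×-dec_; _⊎-dec_)
open import Relation.Nullary.Decidable using (dec-true; dec-false; does-⇔)

-- Power series

open CommutativeSemigroupProperties ℤ.+-commutativeSemigroup using ()
  renaming (interchange to +-interchange)

sumTo-cong : ∀ {h g : ℕ → ℤ} n → (∀ i → i ≤ n → h i ≡ g i) → sumTo h n ≡ sumTo g n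
sumTo-cong zero    h≡g = h≡g 0 z≤n
sumTo-cong (suc n) h≡g =
  cong₂ ℤ._+_ (sumTo-cong n (λ i i≤n → h≡g i (m≤n⇒m≤1+n i≤n))) (h≡g (suc n) ≤-refl)

sumTo-+ : ∀ (h g : ℕ → ℤ) n → sumTo (λ i → h i ℤ.+ g i) n ≡ sumTo h n ℤ.+ sumTo g n
sumTo-+ h g zero    = refl
sumTo-+ h g (suc n) = trans (cong (ℤ._+ (h (suc n) ℤ.+ g (suc n))) (sumTo-+ h g n))
                             (+-interchange (sumTo h n) (sumTo g n) (h (suc n)) (g (suc n)))

sumTo-*ˡ : ∀ c (h : ℕ → ℤ) n → sumTo (λ i → c ℤ.* h i) n ≡ c ℤ.* sumTo h n
sumTo-*ˡ c h zero    = refl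
sumTo-*ˡ c h (suc n) =
  trans (cong (ℤ._+ c ℤ.* h (suc n)) (sumTo-*ˡ c h n)) (sym (ℤ.*-distribˡ-+ c (sumTo h n) (h (suc n))))

sumTo-*ʳ : ∀ c (h : ℕ → ℤ) n → sumTo (λ i → h i ℤ.* c) n ≡ sumTo h n ℤ.* c
sumTo-*ʳ c h zero    = refl
sumTo-*ʳ c h (suc n) =
  trans (cong (ℤ._+ h (suc n) ℤ.* c) (sumTo-*ʳ c h n)) (sym (ℤ.*-distribʳ-+ c (sumTo h n) (h (suc n))))

sumTo-neg : ∀ (h : ℕ → ℤ) n → sumTo (λ i → - h i) n ≡ - sumTo h n
sumTo-neg h zero    = refl
sumTo-neg h (suc n) =
  trans (cong (ℤ._+ - h (suc n)) (sumTo-neg h n)) (sym (ℤ.neg-distrib-+ (sumTo h n) (h (suc n))))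

sumTo-zero : ∀ (h : ℕ → ℤ) n → (∀ i → i ≤ n → h i ≡ + 0) → sumTo h n ≡ + 0
sumTo-zero h zero    h≡0 = h≡0 0 z≤n
sumTo-zero h (suc n) h≡0 = cong₂ ℤ._+_ (sumTo-zero h n (λ i i≤n → h≡0 i (m≤n⇒m≤1+n i≤n)))
                                        (h≡0 (suc n) ≤-refl)

sumTo-single : ∀ (h : ℕ → ℤ) n i₀ → i₀ ≤ n → (∀ i → i ≤ n → i ≢ i₀ → h i ≡ + 0) →
               sumTo h n ≡ h i₀
sumTo-single h zero .zero z≤n _ = refl
sumTo-single h (suc n) i₀ i₀≤1+n h≡0 with i₀ ≟ suc n
... | yes refl = trans (cong (ℤ._+ h i₀) (sumTo-zero h n λ i i≤n → h≡0 i (m≤n⇒m≤1+n i≤n)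
                                                      (<⇒≢ (s≤s i≤n))))
                       (ℤ.+-identityˡ _)
... | no i₀≢1+n = trans (cong₂ ℤ._+_ (sumTo-single h n i₀ (m<1+n⇒m≤n (≤∧≢⇒< i₀≤1+n i₀≢1+n))
                                         (λ i i≤n → h≡0 i (m≤n⇒m≤1+n i≤n)))
                                      (h≡0 (suc n) ≤-refl (≢-sym i₀≢1+n)))
                        (ℤ.+-identityʳ _)

sumTo-nonzero : ∀ (h : ℕ → ℤ) n → sumTo h n ≢ + 0 → ∃[ i ] i ≤ n × h i ≢ + 0
sumTo-nonzero h zero    sum≢0 = 0 , z≤n , sum≢0
sumTo-nonzero h (suc n) sum≢0 with h (suc n) ℤ.≟ + 0
... | no  hₙ≢0 = suc n , ≤-refl , hₙ≢0
... | yes hₙ≡0 with sumTo-nonzero h n (λ s≡0 → sum≢0 (cong₂ ℤ._+_ s≡0 hₙ≡0))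
...   | i , i≤n , hᵢ≢0 = i , m≤n⇒m≤1+n i≤n , hᵢ≢0

sumTo-front : ∀ (h : ℕ → ℤ) n → sumTo h (suc n) ≡ h 0 ℤ.+ sumTo (h ∘ suc) n
sumTo-front h zero    = refl
sumTo-front h (suc n) =
  trans (cong (ℤ._+ h (suc (suc n))) (sumTo-front h n)) (ℤ.+-assoc (h 0) _ _)

sumTo-reverse : ∀ (h : ℕ → ℤ) n → sumTo h n ≡ sumTo (λ i → h (n ∸ i)) n
sumTo-reverse h zero    = refl
sumTo-reverse h (suc n) = begin
  sumTo h n ℤ.+ h (suc n)                      ≡⟨ cong (ℤ._+ h (suc n)) (sumTo-reverse h n) ⟩
  sumTo (λ i → h (n ∸ i)) n ℤ.+ h (suc n)      ≡⟨ ℤ.+-comm _ (h (suc n)) ⟩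
  h (suc n) ℤ.+ sumTo (λ i → h (n ∸ i)) n      ≡⟨ sumTo-front (λ i → h (suc n ∸ i)) n ⟨
  sumTo (λ i → h (suc n ∸ i)) (suc n)          ∎
  where open ≡-Reasoning

sumTo-triangle : ∀ (A : ℕ → ℕ → ℤ) n →
  sumTo (λ i → sumTo (A i) i) n ≡ sumTo (λ j → sumTo (λ l → A (j + l) j) (n ∸ j)) n
sumTo-triangle A zero    = refl
sumTo-triangle A (suc n) = begin
  sumTo (λ i → sumTo (A i) i) n ℤ.+ sumTo (A (suc n)) (suc n)
    ≡⟨ cong (ℤ._+ sumTo (A (suc n)) (suc n)) (sumTo-triangle A n) ⟩
  sumTo R n ℤ.+ (sumTo (A (suc n)) n ℤ.+ A (suc n) (suc n))
    ≡⟨ ℤ.+-assoc (sumTo R n) _ _ ⟨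
  (sumTo R n ℤ.+ sumTo (A (suc n)) n) ℤ.+ A (suc n) (suc n)
    ≡⟨ cong₂ ℤ._+_ (sumTo-+ R (A (suc n)) n) (cong (λ i → A i (suc n)) (+-identityʳ (suc n))) ⟨
  sumTo (λ j → R j ℤ.+ A (suc n) j) n ℤ.+ A (suc n + 0) (suc n)
    ≡⟨ cong₂ ℤ._+_ (sumTo-cong n extendRow)
                   (cong (sumTo (λ l → A (suc n + l) (suc n))) (sym (n∸n≡0 n))) ⟩
  sumTo (λ j → sumTo (λ l → A (j + l) j) (suc n ∸ j)) n
    ℤ.+ sumTo (λ l → A (suc n + l) (suc n)) (n ∸ n) ∎
  where
  open ≡-Reasoning
  R : ℕ → ℤ
  R j = sumTo (λ l → A (j + l) j) (n ∸ j)
  extendRow : ∀ j → j ≤ n → R j ℤ.+ A (suc n) j ≡ sumTo (λ l → A (j + l) j) (suc n ∸ j)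
  extendRow j j≤n rewrite +-∸-assoc 1 j≤n =
    cong (λ i → R j ℤ.+ A i j) (sym (trans (+-suc j (n ∸ j)) (cong suc (m+[n∸m]≡n j≤n))))

infix 4 _≈_
record _≈_ (f g : PS) : Set where
  constructor mk≈
  field at : ∀ n → f n ≡ g n
open _≈_

≈-refl : ∀ {f} → f ≈ f
≈-refl = mk≈ λ _ → refl

≈-reflexive : ∀ {f g} → f ≡ g → f ≈ g
≈-reflexive refl = ≈-refl

≈-sym : ∀ {f g} → f ≈ g → g ≈ f
≈-sym f≈g = mk≈ λ n → sym (at f≈g n)

≈-trans : ∀ {f g h} → f ≈ g → g ≈ h → f ≈ h
≈-trans f≈g g≈h = mk≈ λ n → trans (at f≈g n) (at g≈h n)

⊛-cong : ∀ {f f′ g g′} → f ≈ f′ → g ≈ g′ → f ⊛ g ≈ f′ ⊛ g′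
⊛-cong f≈f′ g≈g′ = mk≈ λ n → sumTo-cong n λ i _ → cong₂ ℤ._*_ (at f≈f′ i) (at g≈g′ (n ∸ i))

⊛-identityˡ : ∀ f → oneS ⊛ f ≈ f
⊛-identityˡ f = mk≈ λ n → trans (sumTo-single _ n 0 z≤n (higher n)) (ℤ.*-identityˡ (f n))
  where
  higher : ∀ n i → i ≤ n → i ≢ 0 → oneS i ℤ.* f (n ∸ i) ≡ + 0
  higher n zero    _ i≢0 = contradiction refl i≢0
  higher n (suc i) _ _   = refl

⊛-comm : ∀ f g → f ⊛ g ≈ g ⊛ f
⊛-comm f g = mk≈ λ n → trans (sumTo-reverse _ n) (sumTo-cong n λ i i≤n →
  trans (cong (λ j → f (n ∸ i) ℤ.* g j) (m∸[m∸n]≡n i≤n)) (ℤ.*-comm (f (n ∸ i)) (g i)))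

⊛-assoc : ∀ f g h → (f ⊛ g) ⊛ h ≈ f ⊛ (g ⊛ h)
⊛-assoc f g h = mk≈ coefficient
  where
  reassociate : ∀ n j l → (f j ℤ.* g (j + l ∸ j)) ℤ.* h (n ∸ (j + l)) ≡ f j ℤ.* (g l ℤ.* h (n ∸ j ∸ l))
  reassociate n j l = trans (cong₂ (λ a b → (f j ℤ.* g a) ℤ.* h b) (m+n∸m≡n j l) (sym (∸-+-assoc n j l)))
                            (ℤ.*-assoc (f j) (g l) (h (n ∸ j ∸ l)))
  coefficient : ∀ n → ((f ⊛ g) ⊛ h) n ≡ (f ⊛ (g ⊛ h)) n
  coefficient n = begin
    sumTo (λ i → sumTo (λ j → f j ℤ.* g (i ∸ j)) i ℤ.* h (n ∸ i)) n
      ≡⟨ sumTo-cong n (λ i _ → sumTo-*ʳ (h (n ∸ i)) (λ j → f j ℤ.* g (i ∸ j)) i) ⟨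
    sumTo (λ i → sumTo (λ j → (f j ℤ.* g (i ∸ j)) ℤ.* h (n ∸ i)) i) n
      ≡⟨ sumTo-triangle (λ i j → (f j ℤ.* g (i ∸ j)) ℤ.* h (n ∸ i)) n ⟩
    sumTo (λ j → sumTo (λ l → (f j ℤ.* g (j + l ∸ j)) ℤ.* h (n ∸ (j + l))) (n ∸ j)) n
      ≡⟨ sumTo-cong n (λ j _ → trans (sumTo-cong (n ∸ j) (λ l _ → reassociate n j l))
                                     (sumTo-*ˡ (f j) (λ l → g l ℤ.* h (n ∸ j ∸ l)) (n ∸ j))) ⟩
    sumTo (λ j → f j ℤ.* sumTo (λ l → g l ℤ.* h (n ∸ j ∸ l)) (n ∸ j)) n ∎
    where open ≡-Reasoning

⊛-commutativeMonoid : CommutativeMonoid 0ℓ 0ℓ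
⊛-commutativeMonoid = record
  { Carrier = PS
  ; _≈_     = _≈_
  ; _∙_     = _⊛_
  ; ε       = oneS
  ; isCommutativeMonoid = record
    { isMonoid = record
      { isSemigroup = record
        { isMagma = record
          { isEquivalence = record { refl = ≈-refl ; sym = ≈-sym ; trans = ≈-trans }
          ; ∙-cong        = ⊛-cong }
        ; assoc = ⊛-assoc }
      ; identity = ⊛-identityˡ , λ f → ≈-trans (⊛-comm f oneS) (⊛-identityˡ f) }
    ; comm = ⊛-comm } }

open CommutativeMonoid ⊛-commutativeMonoid
  using (commutativeSemigroup)
  renaming (setoid to ≈-setoid; identityʳ to ⊛-identityʳ)
open CommutativeSemigroupProperties commutativeSemigroup using (x∙yz≈y∙xz)
module ⊛-Solver = CommutativeMonoidSolver ⊛-commutativeMonoid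
module ≈-Reasoning = SetoidReasoning ≈-setoid

⊛-congˡ : ∀ f {g g′} → g ≈ g′ → f ⊛ g ≈ f ⊛ g′
⊛-congˡ f = ⊛-cong (≈-refl {f})

⊛-congʳ : ∀ {f f′} g → f ≈ f′ → f ⊛ g ≈ f′ ⊛ g
⊛-congʳ g f≈f′ = ⊛-cong f≈f′ (≈-refl {g})

neg : PS → PS
neg f n = - f n

neg-cong : ∀ {f g} → f ≈ g → neg f ≈ neg g
neg-cong f≈g = mk≈ λ n → cong -_ (at f≈g n)

neg-involutive : ∀ f → neg (neg f) ≈ f
neg-involutive f = mk≈ λ n → ℤ.neg-involutive (f n)

neg-⊛ˡ : ∀ f g → neg f ⊛ g ≈ neg (f ⊛ g)
neg-⊛ˡ f g = mk≈ λ n →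
  trans (sumTo-cong n λ i _ → sym (ℤ.neg-distribˡ-* (f i) (g (n ∸ i)))) (sumTo-neg _ n)

neg-⊛ʳ : ∀ f g → f ⊛ neg g ≈ neg (f ⊛ g)
neg-⊛ʳ f g = ≈-trans (⊛-comm f (neg g)) (≈-trans (neg-⊛ˡ g f) (neg-cong (⊛-comm g f)))

neg-injective : ∀ {f g} → neg f ≈ neg g → f ≈ g
neg-injective {f} {g} -f≈-g =
  ≈-trans (≈-sym (neg-involutive f)) (≈-trans (neg-cong -f≈-g) (neg-involutive g))

neg-oneS-⊛ : ∀ f → neg oneS ⊛ f ≈ neg f
neg-oneS-⊛ f = ≈-trans (neg-⊛ˡ oneS f) (neg-cong (⊛-identityˡ f))

infix 4 _≈[_]_
record _≈[_]_ (f : PS) (M : ℕ) (g : PS) : Set where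
  constructor mk≈[]
  field below : ∀ n → n < M → f n ≡ g n
open _≈[_]_

≈⇒≈[] : ∀ {f g M} → f ≈ g → f ≈[ M ] g
≈⇒≈[] f≈g = mk≈[] λ n _ → at f≈g n

≈[]-trans : ∀ {f g h M} → f ≈[ M ] g → g ≈[ M ] h → f ≈[ M ] h
≈[]-trans f≈g g≈h = mk≈[] λ n n<M → trans (below f≈g n n<M) (below g≈h n n<M)

≈[]-weaken : ∀ {f g M M′} → M′ ≤ M → f ≈[ M ] g → f ≈[ M′ ] g
≈[]-weaken M′≤M f≈g = mk≈[] λ n n<M′ → below f≈g n (<-≤-trans n<M′ M′≤M)

⊛-cong-≈[] : ∀ {f f′ g g′ M} → f ≈[ M ] f′ → g ≈[ M ] g′ → f ⊛ g ≈[ M ] f′ ⊛ g′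
⊛-cong-≈[] f≈f′ g≈g′ = mk≈[] λ n n<M → sumTo-cong n λ i i≤n →
  cong₂ ℤ._*_ (below f≈f′ i (≤-<-trans i≤n n<M)) (below g≈g′ (n ∸ i) (≤-<-trans (m∸n≤m n i) n<M))

neg-cong-≈[] : ∀ {f g M} → f ≈[ M ] g → neg f ≈[ M ] neg g
neg-cong-≈[] f≈g = mk≈[] λ n n<M → cong -_ (below f≈g n n<M)

∏< : ℕ → (ℕ → PS) → PS
∏< zero    φ = oneS
∏< (suc l) φ = φ 0 ⊛ ∏< l (φ ∘ suc)

∏<-cong : ∀ l {φ ψ} → (∀ i → i < l → φ i ≈ ψ i) → ∏< l φ ≈ ∏< l ψ
∏<-cong zero    _   = ≈-refl
∏<-cong (suc l) φ≈ψ = ⊛-cong (φ≈ψ 0 z<s) (∏<-cong l λ i i<l → φ≈ψ (suc i) (s≤s i<l))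

∏<-+ : ∀ j l φ → ∏< (j + l) φ ≈ ∏< j φ ⊛ ∏< l (λ i → φ (j + i))
∏<-+ zero    l φ = ≈-sym (⊛-identityˡ (∏< l φ))
∏<-+ (suc j) l φ = ≈-trans (⊛-congˡ (φ 0) (∏<-+ j l (φ ∘ suc)))
                            (≈-sym (⊛-assoc (φ 0) (∏< j (φ ∘ suc)) (∏< l (λ i → φ (suc j + i)))))

∏<-suc : ∀ l φ → ∏< (suc l) φ ≈ ∏< l φ ⊛ φ l
∏<-suc zero    φ = ⊛-comm (φ 0) oneS
∏<-suc (suc l) φ = ≈-trans (⊛-congˡ (φ 0) (∏<-suc l (φ ∘ suc)))
                            (≈-sym (⊛-assoc (φ 0) (∏< l (φ ∘ suc)) (φ (suc l))))

∏<-≈[]-oneS : ∀ l {φ M} → (∀ i → i < l → φ i ≈[ M ] oneS) → ∏< l φ ≈[ M ] oneS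
∏<-≈[]-oneS zero    _    = ≈⇒≈[] ≈-refl
∏<-≈[]-oneS (suc l) φ≈1 = ≈[]-trans
  (⊛-cong-≈[] (φ≈1 0 z<s) (∏<-≈[]-oneS l λ i i<l → φ≈1 (suc i) (s≤s i<l)))
  (≈⇒≈[] (⊛-identityˡ oneS))

∏<-≈[]-first : ∀ l φ {g M} → φ 0 ≈[ M ] g → (∀ i → i < l → φ (suc i) ≈[ M ] oneS) →
               ∏< (suc l) φ ≈[ M ] g
∏<-≈[]-first l φ {g} φ₀≈g rest≈1 =
  ≈[]-trans (⊛-cong-≈[] φ₀≈g (∏<-≈[]-oneS l rest≈1)) (≈⇒≈[] (⊛-identityʳ g))

omit : (ℕ → PS) → ℕ → ℕ → PS
omit φ d i = if does (i ≟ d) then oneS else φ i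

omit-≢ : ∀ φ {d i} → i ≢ d → omit φ d i ≡ φ i
omit-≢ φ {d} {i} i≢d = cong (if_then oneS else φ i) (dec-false (i ≟ d) i≢d)

-- P carries the hypotheses needed when several factors are omitted in turn.
omit-≈oneS : ∀ {P : ℕ → Set} φ d → (∀ i → i ≢ d × P i → φ i ≈ oneS) →
             ∀ i → P i → omit φ d i ≈ oneS
omit-≈oneS φ d φ≈1 i Pi with i ≟ d
... | yes i≡d = ≈-reflexive (cong (if_then oneS else φ i) (dec-true (i ≟ d) i≡d))
... | no  i≢d = ≈-trans (≈-reflexive (omit-≢ φ i≢d)) (φ≈1 i (i≢d , Pi))

∏<-extract : ∀ l φ {d} → d < l → ∏< l φ ≈ φ d ⊛ ∏< l (omit φ d)
∏<-extract (suc l) φ {zero}  _         = ⊛-congˡ (φ 0) (≈-sym (⊛-identityˡ (∏< l (φ ∘ suc))))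
∏<-extract (suc l) φ {suc d} (s≤s d<l) =
  ≈-trans (⊛-congˡ (φ 0) (∏<-extract l (φ ∘ suc) d<l))
          (x∙yz≈y∙xz (φ 0) (φ (suc d)) (∏< l (omit (φ ∘ suc) d)))

∏<-extract-suc : ∀ l φ {D} → 1 ≤ D → D ≤ l → ∏< l (φ ∘ suc) ≈ φ D ⊛ ∏< l (omit φ D ∘ suc)
∏<-extract-suc l φ {suc d} _ d<l = ∏<-extract l (φ ∘ suc) d<l

∏<-oneS : ∀ l {φ} → (∀ i → i < l → φ i ≈ oneS) → ∏< l φ ≈ oneS
∏<-oneS zero    _   = ≈-refl
∏<-oneS (suc l) φ≈1 =
  ≈-trans (⊛-cong (φ≈1 0 z<s) (∏<-oneS l λ i i<l → φ≈1 (suc i) (s<s i<l))) (⊛-identityˡ oneS)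

foldr-if≈∏< : ∀ (b : ℕ → Bool) (F : ℕ → PS) (f : ℕ → ℕ) l →
  foldr (λ i acc → if b i then F i ⊛ acc else acc) oneS (applyUpTo f l)
    ≈ ∏< l (λ i → if b (f i) then F (f i) else oneS)
foldr-if≈∏< b F f zero    = ≈-refl
foldr-if≈∏< b F f (suc l) with b (f 0)
... | true  = ⊛-congˡ (F (f 0)) (foldr-if≈∏< b F (f ∘ suc) l)
... | false = ≈-trans (foldr-if≈∏< b F (f ∘ suc) l) (≈-sym (⊛-identityˡ _))

-- x^d − 1 and its inverse

X : ℕ → PS
X = xPowMinusOne

X⁻¹ : ℕ → PS
X⁻¹ = xPowMinusOneInv

neg-X⁻¹-coeff : ∀ d n → - X⁻¹ d n ≡ ind (does (d ∣? n))
neg-X⁻¹-coeff d n with does (d ∣? n)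
... | true  = refl
... | false = refl

∣∸⇔∣ : ∀ {d m n} → d ∣ m → m ≤ n → (d ∣ n ∸ m ⇔ d ∣ n)
∣∸⇔∣ {d} d∣m m≤n = mk⇔ (λ d∣n∸m → ∣m∸n∣n⇒∣m d m≤n d∣n∸m d∣m)
  (λ d∣n → ∣m+n∣m⇒∣n (subst (d ∣_) (sym (m+[n∸m]≡n m≤n)) d∣n) d∣m)

X⁻¹-periodic : ∀ d {m n} → d ∣ m → m ≤ n → X⁻¹ d (n ∸ m) ≡ X⁻¹ d n
X⁻¹-periodic d d∣m m≤n =
  cong (if_then -[1+ 0 ] else + 0) (does-⇔ (∣∸⇔∣ d∣m m≤n) (d ∣? _) (d ∣? _))

private
  X-shifted-term : ∀ d (g : PS) n i → i ≢ d → X (suc d) (suc i) ℤ.* g (n ∸ i) ≡ + 0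
  X-shifted-term d g n i i≢d =
    cong (λ b → (if b then + 1 else + 0) ℤ.* g (n ∸ i)) (dec-false (i ≟ d) i≢d)

X-⊛-< : ∀ d g n → n < d → (X d ⊛ g) n ≡ - g n
X-⊛-< (suc d) g zero    _         = ℤ.-1*i≡-i (g 0)
X-⊛-< (suc d) g (suc n) (s≤s n≤d) = begin
  (X (suc d) ⊛ g) (suc n)
    ≡⟨ sumTo-front _ n ⟩
  -[1+ 0 ] ℤ.* g (suc n) ℤ.+ sumTo (λ i → X (suc d) (suc i) ℤ.* g (n ∸ i)) n
    ≡⟨ cong₂ ℤ._+_ (ℤ.-1*i≡-i (g (suc n))) (sumTo-zero _ n λ i i≤n →
         X-shifted-term d g n i (<⇒≢ (≤-<-trans i≤n n≤d))) ⟩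
  - g (suc n) ℤ.+ + 0
    ≡⟨ ℤ.+-identityʳ _ ⟩
  - g (suc n) ∎
  where open ≡-Reasoning

X-⊛-≥ : ∀ d g n → 1 ≤ d → d ≤ n → (X d ⊛ g) n ≡ - g n ℤ.+ g (n ∸ d)
X-⊛-≥ (suc d) g (suc n) _ (s≤s d≤n) = begin
  (X (suc d) ⊛ g) (suc n)
    ≡⟨ sumTo-front _ n ⟩
  -[1+ 0 ] ℤ.* g (suc n) ℤ.+ sumTo (λ i → X (suc d) (suc i) ℤ.* g (n ∸ i)) n
    ≡⟨ cong₂ ℤ._+_ (ℤ.-1*i≡-i (g (suc n))) (sumTo-single _ n d d≤n λ i _ → X-shifted-term d g n i) ⟩
  - g (suc n) ℤ.+ X (suc d) (suc d) ℤ.* g (n ∸ d)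
    ≡⟨ cong (λ b → - g (suc n) ℤ.+ (if b then + 1 else + 0) ℤ.* g (n ∸ d)) (dec-true (d ≟ d) refl) ⟩
  - g (suc n) ℤ.+ + 1 ℤ.* g (n ∸ d)
    ≡⟨ cong (ℤ._+_ (- g (suc n))) (ℤ.*-identityˡ (g (n ∸ d))) ⟩
  - g (suc n) ℤ.+ g (n ∸ d) ∎
  where open ≡-Reasoning

X⊛X⁻¹≈oneS : ∀ d → 1 ≤ d → X d ⊛ X⁻¹ d ≈ oneS
X⊛X⁻¹≈oneS d 1≤d = mk≈ coefficient
  where
  coefficient : ∀ n → (X d ⊛ X⁻¹ d) n ≡ oneS n
  coefficient n with n <? d
  ... | yes n<d = trans (X-⊛-< d (X⁻¹ d) n n<d) (trans (neg-X⁻¹-coeff d n) (small n n<d))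
    where
    small : ∀ n → n < d → ind (does (d ∣? n)) ≡ oneS n
    small zero    _   = cong ind (dec-true (d ∣? 0) (d ∣0))
    small (suc n) n<d = cong ind (dec-false (d ∣? suc n) λ d∣n → <⇒≱ n<d (∣⇒≤ d∣n))
  ... | no  n≮d = begin
    (X d ⊛ X⁻¹ d) n                   ≡⟨ X-⊛-≥ d (X⁻¹ d) n 1≤d d≤n ⟩
    - X⁻¹ d n ℤ.+ X⁻¹ d (n ∸ d)       ≡⟨ cong (ℤ._+_ (- X⁻¹ d n)) (X⁻¹-periodic d ∣-refl d≤n) ⟩
    - X⁻¹ d n ℤ.+ X⁻¹ d n             ≡⟨ ℤ.+-inverseˡ (X⁻¹ d n) ⟩
    + 0                               ≡⟨ oneS-positive (≤-trans 1≤d d≤n) ⟨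
    oneS n                            ∎
    where
    open ≡-Reasoning
    d≤n : d ≤ n
    d≤n = ≮⇒≥ n≮d
    oneS-positive : ∀ {n} → 1 ≤ n → oneS n ≡ + 0
    oneS-positive (s≤s _) = refl

X-cancelˡ : ∀ d {f g} → 1 ≤ d → X d ⊛ f ≈ X d ⊛ g → f ≈ g
X-cancelˡ d {f} {g} 1≤d Xf≈Xg = begin
  f                      ≈⟨ ⊛-identityˡ f ⟨
  oneS ⊛ f               ≈⟨ ⊛-congʳ f X⁻¹X≈1 ⟨
  (X⁻¹ d ⊛ X d) ⊛ f      ≈⟨ ⊛-assoc (X⁻¹ d) (X d) f ⟩
  X⁻¹ d ⊛ (X d ⊛ f)      ≈⟨ ⊛-congˡ (X⁻¹ d) Xf≈Xg ⟩
  X⁻¹ d ⊛ (X d ⊛ g)      ≈⟨ ⊛-assoc (X⁻¹ d) (X d) g ⟨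
  (X⁻¹ d ⊛ X d) ⊛ g      ≈⟨ ⊛-congʳ g X⁻¹X≈1 ⟩
  oneS ⊛ g               ≈⟨ ⊛-identityˡ g ⟩
  g                      ∎
  where
  open ≈-Reasoning
  X⁻¹X≈1 : X⁻¹ d ⊛ X d ≈ oneS
  X⁻¹X≈1 = ≈-trans (⊛-comm (X⁻¹ d) (X d)) (X⊛X⁻¹≈oneS d 1≤d)

X≈[]-1 : ∀ d → X d ≈[ d ] neg oneS
X≈[]-1 d = mk≈[] coefficient
  where
  coefficient : ∀ n → n < d → X d n ≡ neg oneS n
  coefficient zero    _   = refl
  coefficient (suc n) n<d = cong (if_then + 1 else + 0) (dec-false (suc n ≟ d) (<⇒≢ n<d))

X⁻¹≈[]-1 : ∀ d → X⁻¹ d ≈[ d ] neg oneS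
X⁻¹≈[]-1 d = mk≈[] coefficient
  where
  coefficient : ∀ n → n < d → X⁻¹ d n ≡ neg oneS n
  coefficient zero    _   = cong (if_then -[1+ 0 ] else + 0) (dec-true (d ∣? 0) (d ∣0))
  coefficient (suc n) n<d =
    cong (if_then -[1+ 0 ] else + 0) (dec-false (d ∣? suc n) λ d∣n → <⇒≱ n<d (∣⇒≤ d∣n))

neg-X≈[]oneS : ∀ d → neg (X d) ≈[ d ] oneS
neg-X≈[]oneS d = ≈[]-trans (neg-cong-≈[] (X≈[]-1 d)) (≈⇒≈[] (neg-involutive oneS))

⊛-neg-X-< : ∀ d g n → n < d → (g ⊛ neg (X d)) n ≡ g n
⊛-neg-X-< d g n n<d = begin
  (g ⊛ neg (X d)) n   ≡⟨ at (≈-trans (⊛-comm g (neg (X d))) (neg-⊛ˡ (X d) g)) n ⟩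
  - (X d ⊛ g) n       ≡⟨ cong -_ (X-⊛-< d g n n<d) ⟩
  - - g n             ≡⟨ ℤ.neg-involutive (g n) ⟩
  g n                 ∎
  where open ≡-Reasoning

⊛-neg-X-self : ∀ d g → 1 ≤ d → (g ⊛ neg (X d)) d ≡ g d ℤ.- g 0
⊛-neg-X-self d g 1≤d = begin
  (g ⊛ neg (X d)) d           ≡⟨ at (≈-trans (⊛-comm g (neg (X d))) (neg-⊛ˡ (X d) g)) d ⟩
  - (X d ⊛ g) d               ≡⟨ cong -_ (X-⊛-≥ d g d 1≤d ≤-refl) ⟩
  - (- g d ℤ.+ g (d ∸ d))     ≡⟨ ℤ.neg-distrib-+ (- g d) (g (d ∸ d)) ⟩
  - - g d ℤ.+ - g (d ∸ d)     ≡⟨ cong₂ ℤ._+_ (ℤ.neg-involutive (g d)) (cong (-_ ∘ g) (n∸n≡0 d)) ⟩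
  g d ℤ.- g 0                 ∎
  where open ≡-Reasoning

-- The first factor with b i = true is the only one contributing below x^{D i + 1}.
∏<-leading : ∀ l (φ : ℕ → PS) (b : ℕ → Bool) (D : ℕ → ℕ) →
  (∀ i → b i ≡ false → φ i ≈ oneS) →
  (∀ i → b i ≡ true → φ i ≈[ suc (D i) ] neg (X (D i))) →
  (∀ i i′ → i < i′ → φ i′ ≈[ suc (D i) ] oneS) →
  ∀ r → r < l → b r ≡ true → ∃[ i ] ∏< l φ ≈[ suc (D i) ] neg (X (D i))
∏<-leading (suc l) φ b D trivial leading higher zero    _         b₀≡true =
  0 , ∏<-≈[]-first l φ (leading 0 b₀≡true) (λ i _ → higher 0 (suc i) z<s)
∏<-leading (suc l) φ b D trivial leading higher (suc r) (s<s r<l) bᵣ≡true with b 0 in b₀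
... | true  = 0 , ∏<-≈[]-first l φ (leading 0 b₀) (λ i _ → higher 0 (suc i) z<s)
... | false with ∏<-leading l (φ ∘ suc) (b ∘ suc) (D ∘ suc) (trivial ∘ suc) (leading ∘ suc)
                   (λ i i′ i<i′ → higher (suc i) (suc i′) (s<s i<i′)) r r<l bᵣ≡true
...   | i , rest≈ = suc i , ≈[]-trans (≈⇒≈[] first≈1) rest≈
  where
  first≈1 : ∏< (suc l) φ ≈ ∏< l (φ ∘ suc)
  first≈1 = ≈-trans (⊛-congʳ (∏< l (φ ∘ suc)) (trivial 0 b₀)) (⊛-identityˡ (∏< l (φ ∘ suc)))

-- Numerical semigroups

indicator : NumericalSemigroup → PS
indicator T n = ind (mem T n)

semigroupPoly≈ : ∀ T → semigroupPoly T ≈ neg (X 1 ⊛ indicator T)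
semigroupPoly≈ T = mk≈ coefficient
  where
  t : PS
  t = indicator T
  coefficient : ∀ n → semigroupPoly T n ≡ neg (X 1 ⊛ t) n
  coefficient zero    = sym (trans (cong -_ (X-⊛-< 1 t 0 z<s)) (ℤ.neg-involutive (t 0)))
  coefficient (suc n) = sym (begin
    - (X 1 ⊛ t) (suc n)          ≡⟨ cong -_ (X-⊛-≥ 1 t (suc n) ≤-refl (s≤s z≤n)) ⟩
    - (- t (suc n) ℤ.+ t n)      ≡⟨ ℤ.neg-distrib-+ (- t (suc n)) (t n) ⟩
    - - t (suc n) ℤ.+ - t n      ≡⟨ cong (ℤ._+ - t n) (ℤ.neg-involutive (t (suc n))) ⟩
    t (suc n) ℤ.- t n            ∎)
    where open ≡-Reasoning

mem-multiple : ∀ T {m} → mem T m ≡ true → ∀ a → mem T (a * m) ≡ true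
mem-multiple T m∈T zero    = mem-zero T
mem-multiple T m∈T (suc a) = mem-closed T _ _ m∈T (mem-multiple T m∈T a)

ind≡1⇒true : ∀ {b} → ind b ≡ + 1 → b ≡ true
ind≡1⇒true {true}  _ = refl
ind≡1⇒true {false} ()

-- m ∈ T forces its multiple N ∈ T, but the N-th coefficient is G N − G 0 = 0.
no-series-gap : ∀ T G {m N} a → N ≡ a * m → m < N → indicator T ≈[ suc N ] G ⊛ neg (X N) →
                G m ≡ + 1 → G N ≡ G 0 → ⊥
no-series-gap T G {m} {N} a N≡am m<N t≈G⊛[1-x^N] Gm≡1 GN≡G0 =
  contradiction (trans (sym (cong ind N∈T)) t-N≡0) λ ()
  where
  m∈T : mem T m ≡ true
  m∈T = ind≡1⇒true (trans (below t≈G⊛[1-x^N] m (<-trans m<N (n<1+n N)))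
                          (trans (⊛-neg-X-< N G m m<N) Gm≡1))
  N∈T : mem T N ≡ true
  N∈T = subst (λ n → mem T n ≡ true) (sym N≡am) (mem-multiple T m∈T a)
  t-N≡0 : indicator T N ≡ + 0
  t-N≡0 = trans (below t≈G⊛[1-x^N] N (n<1+n N))
                (trans (⊛-neg-X-self N G (≤-trans (s≤s z≤n) m<N))
                       (trans (cong (ℤ._- G 0) GN≡G0) (ℤ.+-inverseʳ (G 0))))

_∈⟨_,_⟩ : ℕ → ℕ → ℕ → Set
n ∈⟨ m , q ⟩ = ∃[ a ] ∃[ b ] n ≡ a * m + b * q

∣∧<⇒≡0 : ∀ {m n} → m ∣ n → n < m → n ≡ 0
∣∧<⇒≡0 {n = zero}  _   _   = refl
∣∧<⇒≡0 {n = suc n} m∣n n<m = contradiction (∣⇒≤ m∣n) (<⇒≱ n<m)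

-- j = i + (b - r) q, so m ∣ (b - r) q and by coprimality m ∣ b - r < m.
split-unique≤ : ∀ {m q i j b r} → Coprime m q → m ∣ i → m ∣ j → b < m → r ≤ b →
                i + b * q ≡ j + r * q → i ≡ j
split-unique≤ {m} {q} {i} {j} {b} {r} m⊥q m∣i m∣j b<m r≤b i+bq≡j+rq = begin
  i                  ≡⟨ +-identityʳ i ⟨
  i + 0 * q          ≡⟨ cong (λ c → i + c * q) b∸r≡0 ⟨
  i + (b ∸ r) * q    ≡⟨ j≡ ⟩
  j                  ∎
  where
  open ≡-Reasoning
  j≡ : i + (b ∸ r) * q ≡ j
  j≡ = +-cancelʳ-≡ (r * q) _ _ (begin
    i + (b ∸ r) * q + r * q      ≡⟨ +-assoc i _ _ ⟩
    i + ((b ∸ r) * q + r * q)    ≡⟨ cong (_+_ i) (*-distribʳ-+ q (b ∸ r) r) ⟨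
    i + (b ∸ r + r) * q          ≡⟨ cong (λ c → i + c * q) (m∸n+n≡m r≤b) ⟩
    i + b * q                    ≡⟨ i+bq≡j+rq ⟩
    j + r * q                    ∎)
  m∣[b∸r]q : m ∣ (b ∸ r) * q
  m∣[b∸r]q = ∣m+n∣m⇒∣n (subst (m ∣_) (sym j≡) m∣j) m∣i
  b∸r≡0 : b ∸ r ≡ 0
  b∸r≡0 = ∣∧<⇒≡0 (coprime-divisor m⊥q (subst (m ∣_) (*-comm (b ∸ r) q) m∣[b∸r]q))
                  (≤-<-trans (m∸n≤m b r) b<m)

split-unique : ∀ {m q i j b r} → Coprime m q → m ∣ i → m ∣ j → b < m → r < m →
               i + b * q ≡ j + r * q → i ≡ j
split-unique {b = b} {r} m⊥q m∣i m∣j b<m r<m eq with ≤-total r b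
... | inj₁ r≤b = split-unique≤ m⊥q m∣i m∣j b<m r≤b eq
... | inj₂ b≤r = sym (split-unique≤ m⊥q m∣j m∣i r<m b≤r (sym eq))

ind-∧ : ∀ a b → ind a ℤ.* ind b ≡ ind (a ∧ b)
ind-∧ true  b = ℤ.*-identityˡ (ind b)
ind-∧ false b = refl

-- (x^{mq} − 1)/(x^q − 1) = Σ_{b<m} x^{bq}
geometricSum : ℕ → ℕ → PS
geometricSum m q = X⁻¹ q ⊛ X (m * q)

-- Σ_{n ∈ ⟨m,q⟩} x^n when m and q are coprime
hilbertSeries : ℕ → ℕ → PS
hilbertSeries m q = neg (X⁻¹ m) ⊛ geometricSum m q

semigroupPoly₂ : ℕ → ℕ → PS
semigroupPoly₂ m q = neg (X 1 ⊛ hilbertSeries m q)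

semigroupPoly₂-unfold : ∀ m q → semigroupPoly₂ m q ≈ X 1 ⊛ (X⁻¹ m ⊛ geometricSum m q)
semigroupPoly₂-unfold m q = ≈-trans
  (neg-cong (≈-trans (⊛-congˡ (X 1) (neg-⊛ˡ (X⁻¹ m) (geometricSum m q)))
                     (neg-⊛ʳ (X 1) (X⁻¹ m ⊛ geometricSum m q))))
  (neg-involutive (X 1 ⊛ (X⁻¹ m ⊛ geometricSum m q)))

module TwoGenerators (m q : ℕ) .{{_ : NonZero m}} .{{_ : NonZero q}} where

  CanonicalSplit : ℕ → ℕ → Set
  CanonicalSplit n i = m ∣ i × q ∣ n ∸ i × n ∸ i < m * q

  canonicalSplit? : ∀ n i → Dec (CanonicalSplit n i)
  canonicalSplit? n i = m ∣? i ×-dec q ∣? n ∸ i ×-dec n ∸ i <? m * q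

  geometricSum-coeff : ∀ n → geometricSum m q n ≡ ind (does (q ∣? n) ∧ does (n <? m * q))
  geometricSum-coeff n = trans (at (⊛-comm (X⁻¹ q) (X (m * q))) n) (coefficient (n <? m * q))
    where
    coefficient : (n<mq? : Dec (n < m * q)) → (X (m * q) ⊛ X⁻¹ q) n ≡ ind (does (q ∣? n) ∧ does n<mq?)
    coefficient (yes n<mq) = trans (X-⊛-< (m * q) (X⁻¹ q) n n<mq)
      (trans (neg-X⁻¹-coeff q n) (cong ind (sym (∧-identityʳ (does (q ∣? n))))))
    coefficient (no n≮mq) = begin
      (X (m * q) ⊛ X⁻¹ q) n             ≡⟨ X-⊛-≥ (m * q) (X⁻¹ q) n 1≤mq mq≤n ⟩
      - X⁻¹ q n ℤ.+ X⁻¹ q (n ∸ m * q)   ≡⟨ cong (ℤ._+_ (- X⁻¹ q n)) (X⁻¹-periodic q (n∣m*n m) mq≤n) ⟩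
      - X⁻¹ q n ℤ.+ X⁻¹ q n             ≡⟨ ℤ.+-inverseˡ (X⁻¹ q n) ⟩
      + 0                               ≡⟨ cong ind (∧-zeroʳ (does (q ∣? n))) ⟨
      ind (does (q ∣? n) ∧ false)       ∎
      where
      open ≡-Reasoning
      mq≤n : m * q ≤ n
      mq≤n = ≮⇒≥ n≮mq
      1≤mq : 1 ≤ m * q
      1≤mq = >-nonZero⁻¹ (m * q) {{m*n≢0 m q}}

  hilbertSeries-coeff : ∀ n → hilbertSeries m q n ≡ sumTo (λ i → ind (does (canonicalSplit? n i))) n
  hilbertSeries-coeff n = sumTo-cong n λ i _ →
    trans (cong₂ ℤ._*_ (neg-X⁻¹-coeff m i) (geometricSum-coeff (n ∸ i)))
          (ind-∧ (does (m ∣? i)) (does (q ∣? n ∸ i) ∧ does (n ∸ i <? m * q)))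

  canonicalSplit⇒∈ : ∀ {n i} → i ≤ n → CanonicalSplit n i → n ∈⟨ m , q ⟩
  canonicalSplit⇒∈ {n} {i} i≤n (divides a i≡am , divides b n∸i≡bq , _) =
    a , b , trans (sym (m+[n∸m]≡n i≤n)) (cong₂ _+_ i≡am n∸i≡bq)

  -- n = a m + b q = (a + (b / m) q) m + (b % m) q
  ∈⇒canonicalSplit : ∀ {n} → n ∈⟨ m , q ⟩ → ∃[ i ] i ≤ n × CanonicalSplit n i
  ∈⇒canonicalSplit {n} (a , b , n≡am+bq) =
    i , i≤n , n∣m*n (a + b / m * q) , subst (q ∣_) (sym n∸i≡rq) (n∣m*n r)
      , subst (_< m * q) (sym n∸i≡rq) (*-monoˡ-< q (m%n<n b m))
    where
    r i : ℕ
    r = b % m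
    i = (a + b / m * q) * m
    n≡i+rq : n ≡ i + r * q
    n≡i+rq = begin
      n                              ≡⟨ n≡am+bq ⟩
      a * m + b * q                  ≡⟨ cong (λ c → a * m + c * q) (m≡m%n+[m/n]*n b m) ⟩
      a * m + (r + b / m * m) * q    ≡⟨ solve 5 (λ a m r s q → a :* m :+ (r :+ s :* m) :* q
                                                := (a :+ s :* q) :* m :+ r :* q) refl a m r (b / m) q ⟩
      i + r * q                      ∎
      where
      open ≡-Reasoning
      open NatSolver.+-*-Solver
    i≤n : i ≤ n
    i≤n = subst (i ≤_) (sym n≡i+rq) (m≤m+n i (r * q))
    n∸i≡rq : n ∸ i ≡ r * q
    n∸i≡rq = trans (cong (_∸ i) n≡i+rq) (m+n∸m≡n i (r * q))

  canonicalSplit-unique : ∀ {n i j} → Coprime m q → i ≤ n → j ≤ n →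
                          CanonicalSplit n i → CanonicalSplit n j → i ≡ j
  canonicalSplit-unique {n} {i} {j} m⊥q i≤n j≤n (m∣i , divides b n∸i≡bq , n∸i<mq)
                                               (m∣j , divides r n∸j≡rq , n∸j<mq) =
    split-unique {b = b} {r} m⊥q m∣i m∣j (factor<m n∸i≡bq n∸i<mq) (factor<m n∸j≡rq n∸j<mq)
      (trans (cong (_+_ i) (sym n∸i≡bq)) (trans (m+[n∸m]≡n i≤n)
             (trans (sym (m+[n∸m]≡n j≤n)) (cong (_+_ j) n∸j≡rq))))
    where
    factor<m : ∀ {k c} → k ≡ c * q → k < m * q → c < m
    factor<m refl cq<mq = *-cancelʳ-< q _ m cq<mq

  hilbertSeries-∈ : ∀ {n} → Coprime m q → n ∈⟨ m , q ⟩ → hilbertSeries m q n ≡ + 1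
  hilbertSeries-∈ {n} m⊥q n∈ with ∈⇒canonicalSplit n∈
  ... | i₀ , i₀≤n , split₀ = begin
    hilbertSeries m q n                               ≡⟨ hilbertSeries-coeff n ⟩
    sumTo (λ i → ind (does (canonicalSplit? n i))) n  ≡⟨ sumTo-single _ n i₀ i₀≤n others ⟩
    ind (does (canonicalSplit? n i₀))
      ≡⟨ cong ind (dec-true (canonicalSplit? n i₀) split₀) ⟩
    + 1                                               ∎
    where
    open ≡-Reasoning
    others : ∀ i → i ≤ n → i ≢ i₀ → ind (does (canonicalSplit? n i)) ≡ + 0
    others i i≤n i≢i₀ = cong ind (dec-false (canonicalSplit? n i) λ split →
      i≢i₀ (canonicalSplit-unique m⊥q i≤n i₀≤n split split₀))

  hilbertSeries≡1⇒∈ : ∀ {n} → hilbertSeries m q n ≡ + 1 → n ∈⟨ m , q ⟩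
  hilbertSeries≡1⇒∈ {n} h≡1 = fromNonzeroTerm (sumTo-nonzero _ n sum≢0)
    where
    sum≢0 : sumTo (λ i → ind (does (canonicalSplit? n i))) n ≢ + 0
    sum≢0 sum≡0 = contradiction (trans (sym h≡1) (trans (hilbertSeries-coeff n) sum≡0)) λ ()
    fromNonzeroTerm : ∃[ i ] i ≤ n × ind (does (canonicalSplit? n i)) ≢ + 0 → n ∈⟨ m , q ⟩
    fromNonzeroTerm (i , i≤n , termᵢ≢0) with canonicalSplit? n i
    ... | yes split = canonicalSplit⇒∈ i≤n split
    ... | no  ¬split = contradiction (cong ind (dec-false (canonicalSplit? n i) ¬split)) termᵢ≢0

-- Primes and the Möbius function

prime∣prime⇒≡ : ∀ {d p} → Prime d → Prime p → d ∣ p → d ≡ p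
prime∣prime⇒≡ d-prime p-prime d∣p with prime⇒irreducible p-prime d∣p
... | inj₁ d≡1 = contradiction d≡1 (ℕ.nonTrivial⇒≢1 {{prime⇒nonTrivial d-prime}})
... | inj₂ d≡p = d≡p

prime∤⇒coprime : ∀ {p d} → Prime p → ¬ p ∣ d → Coprime d p
prime∤⇒coprime p-prime p∤d (i∣d , i∣p) with prime⇒irreducible p-prime i∣p
... | inj₁ i≡1 = i≡1
... | inj₂ refl = contradiction i∣d p∤d

count< : ℕ → (ℕ → Bool) → ℕ
count< zero    g = 0
count< (suc l) g = (if g 0 then 1 else 0) + count< l (g ∘ suc)

count<-cong : ∀ l {g h} → (∀ i → i < l → g i ≡ h i) → count< l g ≡ count< l h
count<-cong zero    _   = refl
count<-cong (suc l) g≡h = cong₂ _+_ (cong (if_then 1 else 0) (g≡h 0 z<s))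
                                    (count<-cong l λ i i<l → g≡h (suc i) (s<s i<l))

count<-false : ∀ l → count< l (λ _ → false) ≡ 0
count<-false zero    = refl
count<-false (suc l) = count<-false l

count<-∨ : ∀ l {g h} → (∀ i → g i ∧ h i ≡ false) →
           count< l (λ i → g i ∨ h i) ≡ count< l g + count< l h
count<-∨ zero    _        = refl
count<-∨ (suc l) {g} {h} disjoint with g 0 in g₀ | h 0 in h₀
... | true  | true  = contradiction (trans (sym (cong₂ _∧_ g₀ h₀)) (disjoint 0)) λ ()
... | true  | false = cong suc (count<-∨ l (disjoint ∘ suc))
... | false | true  = trans (cong suc (count<-∨ l (disjoint ∘ suc))) (sym (+-suc _ _))
... | false | false = count<-∨ l (disjoint ∘ suc)

count<-≟ : ∀ l {d} → d < l → count< l (λ i → does (i ≟ d)) ≡ 1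
count<-≟ (suc l) {zero}  _         = cong suc (count<-false l)
count<-≟ (suc l) {suc d} (s<s d<l) = count<-≟ l d<l

count<-suc≟ : ∀ l {d} → 1 ≤ d → d ≤ l → count< l (λ i → does (suc i ≟ d)) ≡ 1
count<-suc≟ l {suc d} _ d<l = count<-≟ l d<l

length-filter-filter : ∀ {P Q : ℕ → Set} (P? : ∀ x → Dec (P x)) (Q? : ∀ x → Dec (Q x)) f l →
  length (filter P? (filter Q? (applyUpTo f l))) ≡ count< l (λ i → does (Q? (f i) ×-dec P? (f i)))
length-filter-filter P? Q? f zero = refl
length-filter-filter P? Q? f (suc l) with does (Q? (f 0))
... | false = length-filter-filter P? Q? (f ∘ suc) l
... | true  with does (P? (f 0))
...   | true  = cong suc (length-filter-filter P? Q? (f ∘ suc) l)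
...   | false = length-filter-filter P? Q? (f ∘ suc) l

numPrimeDivisors-count : ∀ n →
  numPrimeDivisors n ≡ count< n (λ i → does (suc i ∣? n ×-dec prime? (suc i)))
numPrimeDivisors-count n = trans
  (cong (length ∘ filter prime? ∘ filter (_∣? n)) (map-applyUpTo (λ i → i) suc n))
  (length-filter-filter prime? (_∣? n) suc n)

numPrimeDivisors-≡ : ∀ {n p} → 1 ≤ p → p ≤ n → (∀ {d} → (d ∣ n × Prime d) ⇔ d ≡ p) →
                     numPrimeDivisors n ≡ 1
numPrimeDivisors-≡ {n} {p} 1≤p p≤n primeDivisor⇔ = begin
  numPrimeDivisors n
    ≡⟨ numPrimeDivisors-count n ⟩
  count< n (λ i → does (suc i ∣? n ×-dec prime? (suc i)))
    ≡⟨ count<-cong n (λ i _ → does-⇔ primeDivisor⇔ (suc i ∣? n ×-dec prime? (suc i)) (suc i ≟ p)) ⟩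
  count< n (λ i → does (suc i ≟ p))
    ≡⟨ count<-suc≟ n 1≤p p≤n ⟩
  1 ∎
  where open ≡-Reasoning

IsSquareFree : ℕ → Set
IsSquareFree n = ∀ r → 2 ≤ r → ¬ r * r ∣ n

foldr-∧-true : ∀ (h : ℕ → Bool) f l → (∀ i → i < l → h (f i) ≡ true) →
               foldr (λ x b → h x ∧ b) true (applyUpTo f l) ≡ true
foldr-∧-true h f zero    _      = refl
foldr-∧-true h f (suc l) h≡true =
  cong₂ _∧_ (h≡true 0 z<s) (foldr-∧-true h (f ∘ suc) l λ i i<l → h≡true (suc i) (s<s i<l))

foldr-∧-false : ∀ (h : ℕ → Bool) f l {i} → i < l → h (f i) ≡ false →
                foldr (λ x b → h x ∧ b) true (applyUpTo f l) ≡ false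
foldr-∧-false h f (suc l) {zero}  _         h≡false =
  cong (_∧ foldr (λ x b → h x ∧ b) true (applyUpTo (f ∘ suc) l)) h≡false
foldr-∧-false h f (suc l) {suc i} (s<s i<l) h≡false =
  trans (cong (h (f 0) ∧_) (foldr-∧-false h (f ∘ suc) l i<l h≡false)) (∧-zeroʳ (h (f 0)))

squarefree-true : ∀ {n} → IsSquareFree n → squarefree n ≡ true
squarefree-true {n} sf = foldr-∧-true _ (λ i → i) n λ i _ →
  cong not (dec-false ((2 + i) * (2 + i) ∣? n) (sf (2 + i) (s≤s (s≤s z≤n))))

squarefree-false : ∀ {n} r → .{{NonZero n}} → 2 ≤ r → r * r ∣ n → squarefree n ≡ false
squarefree-false         zero          ()                _
squarefree-false         (suc zero)    (s≤s ())          _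
squarefree-false {n} (suc (suc r)) _ r²∣n = foldr-∧-false _ (λ i → i) n r<n
  (cong not (dec-true ((2 + r) * (2 + r) ∣? n) r²∣n))
  where
  r<n : r < n
  r<n = <-≤-trans (m<n+m r (s≤s z≤n)) (∣⇒≤ (∣-trans (m∣m*n {2 + r} (2 + r)) r²∣n))

möbius-squarefree : ∀ n k → squarefree n ≡ true → numPrimeDivisors n ≡ k →
                    möbius n ≡ (if does (2 ∣? k) then + 1 else -[1+ 0 ])
möbius-squarefree n k sf≡true npd≡k =
  cong₂ (λ s k → if s then (if does (2 ∣? k) then + 1 else -[1+ 0 ]) else + 0) sf≡true npd≡k

möbius-square∣ : ∀ {n} r → .{{NonZero n}} → 2 ≤ r → r * r ∣ n → möbius n ≡ + 0
möbius-square∣ {n} r 2≤r r²∣n =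
  cong (if_then (if does (2 ∣? numPrimeDivisors n) then + 1 else -[1+ 0 ]) else + 0)
       (squarefree-false r 2≤r r²∣n)

prime-squarefree : ∀ {p} → Prime p → IsSquareFree p
prime-squarefree {p} p-prime r 2≤r r²∣p with prime⇒irreducible p-prime (∣-trans (m∣m*n {r} r) r²∣p)
... | inj₁ refl = <⇒≱ 2≤r ≤-refl
... | inj₂ refl = ℕ.nonTrivial⇒≢1 {{prime⇒nonTrivial p-prime}}
  (∣1⇒≡1 (*-cancelˡ-∣ p {{prime⇒nonZero p-prime}} (subst (p * p ∣_) (sym (*-identityʳ p)) r²∣p)))

numPrimeDivisors-prime : ∀ {p} → Prime p → numPrimeDivisors p ≡ 1
numPrimeDivisors-prime {p} p-prime =
  numPrimeDivisors-≡ (<⇒≤ (ℕ.nonTrivial⇒n>1 p {{prime⇒nonTrivial p-prime}})) ≤-refl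
    (mk⇔ (λ (d∣p , d-prime) → prime∣prime⇒≡ d-prime p-prime d∣p) λ { refl → ∣-refl , p-prime })

möbius-prime : ∀ {p} → Prime p → möbius p ≡ -[1+ 0 ]
möbius-prime {p} p-prime = möbius-squarefree p 1 (squarefree-true (prime-squarefree p-prime))
                                                 (numPrimeDivisors-prime p-prime)

-- Cyclotomic polynomials

divisorFactor : ℕ → ℕ → PS
divisorFactor n zero    = oneS
divisorFactor n (suc d) = if does (suc d ∣? n) then powFactor (suc d) (möbius (n / suc d)) else oneS

cyclotomic≈∏< : ∀ n → cyclotomic n ≈ ∏< n (divisorFactor n ∘ suc)
cyclotomic≈∏< n =
  foldr-if≈∏< (λ i → does (suc i ∣? n)) (λ i → powFactor (suc i) (möbius (n / suc i))) (λ i → i) n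

divisorFactor-∤ : ∀ {n} D → ¬ D ∣ n → divisorFactor n D ≡ oneS
divisorFactor-∤ zero    _   = refl
divisorFactor-∤ {n} (suc d) D∤n =
  cong (if_then powFactor (suc d) (möbius (n / suc d)) else oneS) (dec-false (suc d ∣? n) D∤n)

divisorFactor-∣ : ∀ {n} D k → 1 ≤ D → n ≡ k * D → divisorFactor n D ≡ powFactor D (möbius k)
divisorFactor-∣ (suc d) k _ refl = trans
  (cong (if_then powFactor (suc d) (möbius (k * suc d / suc d)) else oneS)
        (dec-true (suc d ∣? k * suc d) (n∣m*n k)))
  (cong (powFactor (suc d) ∘ möbius) (m*n/n≡m k (suc d)))

module DistinctPrimes {p q : ℕ} (p-prime : Prime p) (q-prime : Prime q) (p≢q : p ≢ q) where

  instance
    p≢0 : NonZero p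
    p≢0 = prime⇒nonZero p-prime
    q≢0 : NonZero q
    q≢0 = prime⇒nonZero q-prime

  1<p : 1 < p
  1<p = ℕ.nonTrivial⇒n>1 p {{prime⇒nonTrivial p-prime}}

  1<q : 1 < q
  1<q = ℕ.nonTrivial⇒n>1 q {{prime⇒nonTrivial q-prime}}

  p∤q : ¬ p ∣ q
  p∤q p∣q = p≢q (prime∣prime⇒≡ p-prime q-prime p∣q)

  q∤p : ¬ q ∣ p
  q∤p q∣p = p≢q (sym (prime∣prime⇒≡ q-prime p-prime q∣p))

  pq-squarefree : IsSquareFree (p * q)
  pq-squarefree r 2≤r r²∣pq with p ∣? r
  ... | yes p∣r = p∤q (*-cancelˡ-∣ p (∣-trans (*-pres-∣ p∣r p∣r) r²∣pq))
  ... | no  p∤r with prime⇒irreducible q-prime r∣q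
    where
    r∣q : r ∣ q
    r∣q = coprime-divisor (prime∤⇒coprime p-prime p∤r) (∣-trans (m∣m*n {r} r) r²∣pq)
  ...   | inj₁ refl = <⇒≱ 2≤r ≤-refl
  ...   | inj₂ refl = q∤p (*-cancelʳ-∣ q r²∣pq)

  primeDivisor⇔ : ∀ {d} → (d ∣ p * q × Prime d) ⇔ (d ≡ p ⊎ d ≡ q)
  primeDivisor⇔ {d} = mk⇔ to λ { (inj₁ refl) → m∣m*n q , p-prime ; (inj₂ refl) → n∣m*n p , q-prime }
    where
    to : d ∣ p * q × Prime d → d ≡ p ⊎ d ≡ q
    to (d∣pq , d-prime) with euclidsLemma p q d-prime d∣pq
    ... | inj₁ d∣p = inj₁ (prime∣prime⇒≡ d-prime p-prime d∣p)
    ... | inj₂ d∣q = inj₂ (prime∣prime⇒≡ d-prime q-prime d∣q)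

  numPrimeDivisors-pq : numPrimeDivisors (p * q) ≡ 2
  numPrimeDivisors-pq = begin
    numPrimeDivisors (p * q)
      ≡⟨ numPrimeDivisors-count (p * q) ⟩
    count< (p * q) (λ i → does (suc i ∣? p * q ×-dec prime? (suc i)))
      ≡⟨ count<-cong (p * q) (λ i _ →
           does-⇔ primeDivisor⇔ (suc i ∣? p * q ×-dec prime? (suc i)) ((suc i ≟ p) ⊎-dec (suc i ≟ q))) ⟩
    count< (p * q) (λ i → does (suc i ≟ p) ∨ does (suc i ≟ q))
      ≡⟨ count<-∨ (p * q) (λ i → dec-false ((suc i ≟ p) ×-dec (suc i ≟ q))
                                   λ (i≡p , i≡q) → p≢q (trans (sym i≡p) i≡q)) ⟩
    count< (p * q) (λ i → does (suc i ≟ p)) + count< (p * q) (λ i → does (suc i ≟ q))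
      ≡⟨ cong₂ _+_ (count<-suc≟ (p * q) (<⇒≤ 1<p) (m≤m*n p q))
                   (count<-suc≟ (p * q) (<⇒≤ 1<q) (m≤n*m q p)) ⟩
    2 ∎
    where open ≡-Reasoning

  möbius-pq : möbius (p * q) ≡ + 1
  möbius-pq = möbius-squarefree (p * q) 2 (squarefree-true pq-squarefree) numPrimeDivisors-pq

  ∣p^a*q⇒ : ∀ a {d} → d ∣ p ^ a * q → ∃[ b ] b ≤ a × (d ≡ p ^ b ⊎ d ≡ p ^ b * q)
  ∣p^a*q⇒ zero {d} d∣q with prime⇒irreducible q-prime (subst (d ∣_) (*-identityˡ q) d∣q)
  ... | inj₁ d≡1 = 0 , z≤n , inj₁ d≡1
  ... | inj₂ d≡q = 0 , z≤n , inj₂ (trans d≡q (sym (*-identityˡ q)))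
  ∣p^a*q⇒ (suc a) {d} d∣p^[1+a]q with p ∣? d
  ... | yes (divides c refl) with ∣p^a*q⇒ a c∣p^aq
    where
    c∣p^aq : c ∣ p ^ a * q
    c∣p^aq = *-cancelˡ-∣ p (subst₂ _∣_ (*-comm c p) (*-assoc p (p ^ a) q) d∣p^[1+a]q)
  ...   | b , b≤a , inj₁ refl = suc b , s≤s b≤a , inj₁ (*-comm (p ^ b) p)
  ...   | b , b≤a , inj₂ refl =
    suc b , s≤s b≤a , inj₂ (trans (*-comm (p ^ b * q) p) (sym (*-assoc p (p ^ b) q)))
  ∣p^a*q⇒ (suc a) {d} d∣p^[1+a]q | no p∤d with ∣p^a*q⇒ a d∣p^aq
    where
    d∣p^aq : d ∣ p ^ a * q
    d∣p^aq = coprime-divisor (prime∤⇒coprime p-prime p∤d) (subst (d ∣_) (*-assoc p (p ^ a) q) d∣p^[1+a]q)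
  ...   | b , b≤a , d≡ = b , m≤n⇒m≤1+n b≤a , d≡

  1≤p^ : ∀ a → 1 ≤ p ^ a
  1≤p^ a = m^n>0 p a

  p^<p^suc : ∀ a → p ^ a < p ^ suc a
  p^<p^suc a = ^-monoʳ-< p 1<p (n<1+n a)

  p²∣p^[2+c] : ∀ c → p * p ∣ p ^ (2 + c)
  p²∣p^[2+c] c = *-pres-∣ (∣-refl {p}) (m∣m*n (p ^ c))

  module _ (s : ℕ) where

    private
      n : ℕ
      n = p ^ suc s * q

      φ : ℕ → PS
      φ = divisorFactor n

      p^s<p^s*q : p ^ s < p ^ s * q
      p^s<p^s*q = m<m*n (p ^ s) q {{m^n≢0 p s}} 1<q

      p^[1+s]<n : p ^ suc s < n
      p^[1+s]<n = m<m*n (p ^ suc s) q {{m^n≢0 p (suc s)}} 1<q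

      p^s*q<n : p ^ s * q < n
      p^s*q<n = *-monoˡ-< q (p^<p^suc s)

      p^[1+s]≢p^s*q : p ^ suc s ≢ p ^ s * q
      p^[1+s]≢p^s*q e = p≢q (*-cancelʳ-≡ p q (p ^ s) {{m^n≢0 p s}} (trans e (*-comm (p ^ s) q)))

      p^[c+b]q≡ : ∀ b c → c + b ≡ suc s → n ≡ p ^ c * p ^ b * q
      p^[c+b]q≡ b c c+b≡1+s = trans (cong (λ e → p ^ e * q) (sym c+b≡1+s))
                                     (cong (_* q) (^-distribˡ-+-* p c b))

      trivialFactor : ∀ D k → 1 ≤ D → n ≡ k * D → p * p ∣ k → φ D ≈ oneS
      trivialFactor D k 1≤D n≡kD p²∣k = ≈-reflexive (trans (divisorFactor-∣ D k 1≤D n≡kD)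
        (cong (powFactor D) (möbius-square∣ p {{k≢0}} 1<p p²∣k)))
        where
        k≢0 : NonZero k
        k≢0 = m*n≢0⇒m≢0 k {{subst NonZero n≡kD (m*n≢0 (p ^ suc s) q {{m^n≢0 p (suc s)}})}}

      otherFactor-trivial : ∀ D → D ≢ n × D ≢ p ^ s × D ≢ p ^ suc s × D ≢ p ^ s * q × ⊤ → φ D ≈ oneS
      otherFactor-trivial zero _ = ≈-refl
      otherFactor-trivial D@(suc _) (D≢n , D≢p^s , D≢p^[1+s] , D≢p^s*q , _) with D ∣? n
      ... | no  D∤n = ≈-reflexive (divisorFactor-∤ D D∤n)
      ... | yes D∣n with ∣p^a*q⇒ (suc s) D∣n
      ...   | b , b≤1+s , inj₁ D≡p^b = powerOfP (suc s ∸ b) (m∸n+n≡m b≤1+s)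
        where
        powerOfP : ∀ c → c + b ≡ suc s → φ D ≈ oneS
        powerOfP zero          b≡1+s   = contradiction (trans D≡p^b (cong (p ^_) b≡1+s)) D≢p^[1+s]
        powerOfP (suc zero)    1+b≡1+s =
          contradiction (trans D≡p^b (cong (p ^_) (suc-injective 1+b≡1+s))) D≢p^s
        powerOfP (suc (suc c)) c+b≡1+s = trivialFactor D (p ^ (2 + c) * q) z<s
          (trans (p^[c+b]q≡ b (2 + c) c+b≡1+s)
            (trans (solve 3 (λ x y z → x :* y :* z := x :* z :* y) refl (p ^ (2 + c)) (p ^ b) q)
                   (cong (p ^ (2 + c) * q *_) (sym D≡p^b))))
          (∣m⇒∣m*n q (p²∣p^[2+c] c))
          where open NatSolver.+-*-Solver
      ...   | b , b≤1+s , inj₂ D≡p^bq = powerOfPTimesQ (suc s ∸ b) (m∸n+n≡m b≤1+s)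
        where
        powerOfPTimesQ : ∀ c → c + b ≡ suc s → φ D ≈ oneS
        powerOfPTimesQ zero          b≡1+s   =
          contradiction (trans D≡p^bq (cong (λ e → p ^ e * q) b≡1+s)) D≢n
        powerOfPTimesQ (suc zero)    1+b≡1+s =
          contradiction (trans D≡p^bq (cong (λ e → p ^ e * q) (suc-injective 1+b≡1+s))) D≢p^s*q
        powerOfPTimesQ (suc (suc c)) c+b≡1+s = trivialFactor D (p ^ (2 + c)) z<s
          (trans (p^[c+b]q≡ b (2 + c) c+b≡1+s)
            (trans (*-assoc (p ^ (2 + c)) (p ^ b) q) (cong (p ^ (2 + c) *_) (sym D≡p^bq))))
          (p²∣p^[2+c] c)

      φ₁ φ₂ φ₃ φ₄ : ℕ → PS
      φ₁ = omit φ n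
      φ₂ = omit φ₁ (p ^ s)
      φ₃ = omit φ₂ (p ^ suc s)
      φ₄ = omit φ₃ (p ^ s * q)

      extract : ∀ ψ D {F R} → 1 ≤ D → D ≤ n → ψ D ≈ F → ∏< n (omit ψ D ∘ suc) ≈ R →
                ∏< n (ψ ∘ suc) ≈ F ⊛ R
      extract ψ D 1≤D D≤n ψD≈F rest = ≈-trans (∏<-extract-suc n ψ 1≤D D≤n) (⊛-cong ψD≈F rest)

      1≤n : 1 ≤ n
      1≤n = >-nonZero⁻¹ n {{m*n≢0 (p ^ suc s) q {{m^n≢0 p (suc s)}}}}

      p^s<p^[1+s] : p ^ s < p ^ suc s
      p^s<p^[1+s] = p^<p^suc s

      factor-n : φ n ≈ X n
      factor-n = ≈-reflexive (divisorFactor-∣ n 1 1≤n (sym (*-identityˡ n)))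

      factor-p^s : φ₁ (p ^ s) ≈ X (p ^ s)
      factor-p^s = ≈-reflexive (begin
        φ₁ (p ^ s)                         ≡⟨ omit-≢ φ (<⇒≢ (<-trans p^s<p^[1+s] p^[1+s]<n)) ⟩
        φ (p ^ s)                          ≡⟨ divisorFactor-∣ (p ^ s) (p * q) (1≤p^ s) n≡pq*p^s ⟩
        powFactor (p ^ s) (möbius (p * q)) ≡⟨ cong (powFactor (p ^ s)) möbius-pq ⟩
        X (p ^ s)                          ∎)
        where
        open ≡-Reasoning
        n≡pq*p^s : n ≡ p * q * p ^ s
        n≡pq*p^s = solve 3 (λ p q x → p :* x :* q := p :* q :* x) refl p q (p ^ s)
          where open NatSolver.+-*-Solver

      factor-p^[1+s] : φ₂ (p ^ suc s) ≈ X⁻¹ (p ^ suc s)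
      factor-p^[1+s] = ≈-reflexive (begin
        φ₂ (p ^ suc s)                     ≡⟨ omit-≢ φ₁ (≢-sym (<⇒≢ p^s<p^[1+s])) ⟩
        φ₁ (p ^ suc s)                     ≡⟨ omit-≢ φ (<⇒≢ p^[1+s]<n) ⟩
        φ (p ^ suc s)                      ≡⟨ divisorFactor-∣ (p ^ suc s) q (1≤p^ (suc s)) (*-comm _ q) ⟩
        powFactor (p ^ suc s) (möbius q)   ≡⟨ cong (powFactor (p ^ suc s)) (möbius-prime q-prime) ⟩
        X⁻¹ (p ^ suc s)                    ∎)
        where open ≡-Reasoning

      factor-p^s*q : φ₃ (p ^ s * q) ≈ X⁻¹ (p ^ s * q)
      factor-p^s*q = ≈-reflexive (begin
        φ₃ (p ^ s * q)                     ≡⟨ omit-≢ φ₂ (≢-sym p^[1+s]≢p^s*q) ⟩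
        φ₂ (p ^ s * q)                     ≡⟨ omit-≢ φ₁ (≢-sym (<⇒≢ p^s<p^s*q)) ⟩
        φ₁ (p ^ s * q)                     ≡⟨ omit-≢ φ (<⇒≢ p^s*q<n) ⟩
        φ (p ^ s * q)                      ≡⟨ divisorFactor-∣ (p ^ s * q) p (*-mono-≤ (1≤p^ s) (<⇒≤ 1<q))
                                                              (*-assoc p (p ^ s) q) ⟩
        powFactor (p ^ s * q) (möbius p)   ≡⟨ cong (powFactor (p ^ s * q)) (möbius-prime p-prime) ⟩
        X⁻¹ (p ^ s * q)                    ∎)
        where open ≡-Reasoning

      remainingFactors-trivial : ∀ D → φ₄ D ≈ oneS
      remainingFactors-trivial D =
        omit-≈oneS φ₃ _ (omit-≈oneS φ₂ _ (omit-≈oneS φ₁ _ (omit-≈oneS φ _ otherFactor-trivial))) D tt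

    cyclotomic-p^[1+s]q : cyclotomic (p ^ suc s * q)
                          ≈ X (p ^ suc s * q) ⊛ (X (p ^ s) ⊛ (X⁻¹ (p ^ suc s) ⊛ X⁻¹ (p ^ s * q)))
    cyclotomic-p^[1+s]q = ≈-trans (cyclotomic≈∏< n)
      (extract φ n 1≤n ≤-refl factor-n
      (extract φ₁ (p ^ s) (1≤p^ s) (<⇒≤ (<-trans p^s<p^[1+s] p^[1+s]<n)) factor-p^s
      (extract φ₂ (p ^ suc s) (1≤p^ (suc s)) (<⇒≤ p^[1+s]<n) factor-p^[1+s]
      (≈-trans (extract φ₃ (p ^ s * q) (*-mono-≤ (1≤p^ s) (<⇒≤ 1<q)) (<⇒≤ p^s*q<n) factor-p^s*q
                        (∏<-oneS n λ i _ → remainingFactors-trivial (suc i)))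
               (⊛-identityʳ (X⁻¹ (p ^ s * q)))))))

  p^⊥q : ∀ a → Coprime (p ^ a) q
  p^⊥q a = prime∤⇒coprime q-prime (q∤p^ a)
    where
    q∤p^ : ∀ a → ¬ q ∣ p ^ a
    q∤p^ zero    q∣1     = ℕ.nonTrivial⇒≢1 {{prime⇒nonTrivial q-prime}} (∣1⇒≡1 q∣1)
    q∤p^ (suc a) q∣p^[1+a] with euclidsLemma p (p ^ a) q-prime q∣p^[1+a]
    ... | inj₁ q∣p   = q∤p q∣p
    ... | inj₂ q∣p^a = q∤p^ a q∣p^a

  Φ : ℕ → PS
  Φ j = cyclotomic (p ^ suc j * q)

  Φ-low : ∀ j → Φ j ≈[ suc (p ^ j) ] neg (X (p ^ j))
  Φ-low j = ≈[]-trans (≈⇒≈[] (cyclotomic-p^[1+s]q j))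
    (≈[]-trans (⊛-cong-≈[] (≈[]-weaken (<-trans (p^<p^suc j) (m<m*n _ q {{m^n≢0 p (suc j)}} 1<q))
                                       (X≈[]-1 (p ^ suc j * q)))
               (⊛-cong-≈[] (≈⇒≈[] (≈-refl {X (p ^ j)}))
               (⊛-cong-≈[] (≈[]-weaken (p^<p^suc j) (X⁻¹≈[]-1 (p ^ suc j)))
                           (≈[]-weaken (m<m*n _ q {{m^n≢0 p j}} 1<q) (X⁻¹≈[]-1 (p ^ j * q))))))
    (≈⇒≈[] lowTerms))
    where
    lowTerms : neg oneS ⊛ (X (p ^ j) ⊛ (neg oneS ⊛ neg oneS)) ≈ neg (X (p ^ j))
    lowTerms = ≈-trans (neg-oneS-⊛ _) (neg-cong (≈-trans
      (⊛-congˡ (X (p ^ j)) (≈-trans (neg-oneS-⊛ (neg oneS)) (neg-involutive oneS)))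
      (⊛-identityʳ (X (p ^ j)))))

  Φ≈[]oneS : ∀ j → Φ j ≈[ p ^ j ] oneS
  Φ≈[]oneS j = ≈[]-trans (≈[]-weaken (n≤1+n _) (Φ-low j)) (neg-X≈[]oneS (p ^ j))

  -- ∏< j Φ = Φ_{pq} ⋯ Φ_{p^j q} telescopes.
  ∏<Φ≈semigroupPoly₂ : ∀ j → ∏< j Φ ≈ semigroupPoly₂ (p ^ j) q
  ∏<Φ≈semigroupPoly₂ zero = ≈-sym (begin
    semigroupPoly₂ 1 q
      ≈⟨ semigroupPoly₂-unfold 1 q ⟩
    X 1 ⊛ (X⁻¹ 1 ⊛ (X⁻¹ q ⊛ X (1 * q)))
      ≈⟨ ⊛-Solver.solve 4 (λ a b c d → a ⊕ (b ⊕ (c ⊕ d)) ⊜ (a ⊕ b) ⊕ (d ⊕ c))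
           ≈-refl (X 1) (X⁻¹ 1) (X⁻¹ q) (X (1 * q)) ⟩
    (X 1 ⊛ X⁻¹ 1) ⊛ (X (1 * q) ⊛ X⁻¹ q)
      ≈⟨ ⊛-cong (X⊛X⁻¹≈oneS 1 ≤-refl)
                (≈-trans (⊛-congʳ (X⁻¹ q) (≈-reflexive (cong X (*-identityˡ q))))
                         (X⊛X⁻¹≈oneS q (<⇒≤ 1<q))) ⟩
    oneS ⊛ oneS
      ≈⟨ ⊛-identityˡ oneS ⟩
    oneS ∎)
    where
    open ≈-Reasoning
    open ⊛-Solver using (_⊕_; _⊜_)
  ∏<Φ≈semigroupPoly₂ (suc j) = begin
    ∏< (suc j) Φ
      ≈⟨ ∏<-suc j Φ ⟩
    ∏< j Φ ⊛ Φ j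
      ≈⟨ ⊛-cong (≈-trans (∏<Φ≈semigroupPoly₂ j) (semigroupPoly₂-unfold m q)) (cyclotomic-p^[1+s]q j) ⟩
    (X 1 ⊛ (X⁻¹ m ⊛ (X⁻¹ q ⊛ X (m * q)))) ⊛ (X (m′ * q) ⊛ (X m ⊛ (X⁻¹ m′ ⊛ X⁻¹ (m * q))))
      ≈⟨ ⊛-Solver.solve 8 (λ a b c d e f g h → (a ⊕ (b ⊕ (c ⊕ d))) ⊕ (e ⊕ (f ⊕ (g ⊕ h)))
                                              ⊜ (d ⊕ h) ⊕ ((f ⊕ b) ⊕ (a ⊕ (g ⊕ (c ⊕ e)))))
           ≈-refl (X 1) (X⁻¹ m) (X⁻¹ q) (X (m * q)) (X (m′ * q)) (X m) (X⁻¹ m′) (X⁻¹ (m * q)) ⟩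
    (X (m * q) ⊛ X⁻¹ (m * q)) ⊛ ((X m ⊛ X⁻¹ m) ⊛ P′)
      ≈⟨ ⊛-cong (X⊛X⁻¹≈oneS (m * q) (*-mono-≤ (1≤p^ j) (<⇒≤ 1<q)))
                (⊛-congʳ P′ (X⊛X⁻¹≈oneS m (1≤p^ j))) ⟩
    oneS ⊛ (oneS ⊛ P′)
      ≈⟨ ≈-trans (⊛-identityˡ (oneS ⊛ P′)) (⊛-identityˡ P′) ⟩
    P′
      ≈⟨ semigroupPoly₂-unfold m′ q ⟨
    semigroupPoly₂ m′ q ∎
    where
    open ≈-Reasoning
    open ⊛-Solver using (_⊕_; _⊜_)
    m m′ : ℕ
    m  = p ^ j
    m′ = p ^ suc j
    P′ : PS
    P′ = X 1 ⊛ (X⁻¹ m′ ⊛ geometricSum m′ q)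

  module ProductIsSemigroupPoly (e : ℕ → Bool) (k : ℕ) (e-k : e k ≡ true) (T : NumericalSemigroup)
           (product≈P_T : cycloProduct p q e k ≈ semigroupPoly T) where

    ψ : ℕ → PS
    ψ j = if e (suc j) then Φ j else oneS

    ψ-true : ∀ j → e (suc j) ≡ true → ψ j ≡ Φ j
    ψ-true j e-1+j = cong (if_then Φ j else oneS) e-1+j

    ψ-false : ∀ j → e (suc j) ≡ false → ψ j ≡ oneS
    ψ-false j e-1+j = cong (if_then Φ j else oneS) e-1+j

    ψ≈[]oneS : ∀ j → ψ j ≈[ p ^ j ] oneS
    ψ≈[]oneS j with e (suc j)
    ... | true  = Φ≈[]oneS j
    ... | false = ≈⇒≈[] ≈-refl

    OnesUpTo : ℕ → Set
    OnesUpTo j = ∀ i → i < j → e (suc i) ≡ true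

    ∏<ψ≈semigroupPoly₂ : ∀ j → OnesUpTo j → ∏< j ψ ≈ semigroupPoly₂ (p ^ j) q
    ∏<ψ≈semigroupPoly₂ j ones =
      ≈-trans (∏<-cong j λ i i<j → ≈-reflexive (ψ-true i (ones i i<j))) (∏<Φ≈semigroupPoly₂ j)

    indicator≈ : ∀ j l → OnesUpTo j → j + l ≡ k →
                 indicator T ≈ hilbertSeries (p ^ j) q ⊛ ∏< l (λ i → ψ (j + i))
    indicator≈ j l ones j+l≡k = X-cancelˡ 1 ≤-refl (neg-injective (begin
      neg (X 1 ⊛ indicator T)            ≈⟨ semigroupPoly≈ T ⟨
      semigroupPoly T                    ≈⟨ product≈P_T ⟨
      cycloProduct p q e k               ≈⟨ foldr-if≈∏< (e ∘ suc) Φ (λ i → i) k ⟩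
      ∏< k ψ                             ≡⟨ cong (λ n → ∏< n ψ) j+l≡k ⟨
      ∏< (j + l) ψ                       ≈⟨ ∏<-+ j l ψ ⟩
      ∏< j ψ ⊛ R                         ≈⟨ ⊛-congʳ R (∏<ψ≈semigroupPoly₂ j ones) ⟩
      neg (X 1 ⊛ H) ⊛ R                  ≈⟨ neg-⊛ˡ (X 1 ⊛ H) R ⟩
      neg ((X 1 ⊛ H) ⊛ R)                ≈⟨ neg-cong (⊛-assoc (X 1) H R) ⟩
      neg (X 1 ⊛ (H ⊛ R))                ∎))
      where
      open ≈-Reasoning
      H R : PS
      H = hilbertSeries (p ^ j) q
      R = ∏< l (λ i → ψ (j + i))

    leadingTerm : ∀ j l → OnesUpTo j → e (suc j) ≡ false → suc j + suc l ≡ k →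
      ∃[ i ] indicator T ≈[ suc (p ^ (j + suc i)) ] hilbertSeries (p ^ j) q ⊛ neg (X (p ^ (j + suc i)))
    leadingTerm j l ones e-1+j 2+j+l≡k with
      ∏<-leading (suc l) (λ i → ψ (j + suc i)) (λ i → e (suc (j + suc i))) (λ i → p ^ (j + suc i))
                 (λ i → ≈-reflexive ∘ ψ-false (j + suc i)) leading higher l ≤-refl (trans (cong e 2+j+l≡k) e-k)
      where
      leading : ∀ i → e (suc (j + suc i)) ≡ true →
                ψ (j + suc i) ≈[ suc (p ^ (j + suc i)) ] neg (X (p ^ (j + suc i)))
      leading i e-i = subst (_≈[ suc (p ^ (j + suc i)) ] neg (X (p ^ (j + suc i))))
                            (sym (ψ-true (j + suc i) e-i)) (Φ-low (j + suc i))
      higher : ∀ i i′ → i < i′ → ψ (j + suc i′) ≈[ suc (p ^ (j + suc i)) ] oneS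
      higher i i′ i<i′ = ≈[]-weaken (^-monoʳ-< p 1<p (+-monoʳ-< j (s<s i<i′))) (ψ≈[]oneS (j + suc i′))
    ... | i , R≈[]1-x^N = i , ≈[]-trans (≈⇒≈[] t≈H⊛R) (⊛-cong-≈[] (≈⇒≈[] (≈-refl {H})) R≈[]1-x^N)
      where
      H R : PS
      H = hilbertSeries (p ^ j) q
      R = ∏< (suc l) (λ i → ψ (j + suc i))
      ψⱼ≈1 : ψ (j + 0) ≈ oneS
      ψⱼ≈1 = ≈-reflexive (ψ-false (j + 0) (trans (cong (e ∘ suc) (+-identityʳ j)) e-1+j))
      t≈H⊛R : indicator T ≈ H ⊛ R
      t≈H⊛R = ≈-trans (indicator≈ j (suc (suc l)) ones (trans (+-suc j (suc l)) 2+j+l≡k))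
                      (⊛-congˡ H (≈-trans (⊛-congʳ R ψⱼ≈1) (⊛-identityˡ R)))

    no-gap : ∀ j → OnesUpTo j → e (suc j) ≡ false → j < k → ⊥
    no-gap j ones e-1+j j<k with m≤n⇒∃[o]m+o≡n j<k
    ... | zero  , 1+j+0≡k = contradiction
      (trans (sym e-k) (trans (cong e (trans (sym 1+j+0≡k) (cong suc (+-identityʳ j)))) e-1+j)) λ ()
    ... | suc l , 2+j+l≡k with leadingTerm j l ones e-1+j 2+j+l≡k
    ...   | i , t≈[]H⊛[1-x^N] =
      no-series-gap T H (p ^ suc i) N≡p^[1+i]*m m<N t≈[]H⊛[1-x^N] H-m (trans H-N (sym H-0))
      where
      open TwoGenerators (p ^ j) q {{m^n≢0 p j}}
      m N : ℕ
      m = p ^ j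
      N = p ^ (j + suc i)
      H : PS
      H = hilbertSeries m q
      m<N : m < N
      m<N = ^-monoʳ-< p 1<p (m<m+n j z<s)
      N≡p^[1+i]*m : N ≡ p ^ suc i * m
      N≡p^[1+i]*m = trans (cong (p ^_) (+-comm j (suc i))) (^-distribˡ-+-* p (suc i) j)
      H-m : H m ≡ + 1
      H-m = hilbertSeries-∈ (p^⊥q j) (1 , 0 , sym (trans (+-identityʳ (1 * m)) (*-identityˡ m)))
      H-N : H N ≡ + 1
      H-N = hilbertSeries-∈ (p^⊥q j) (p ^ suc i , 0 , trans N≡p^[1+i]*m (sym (+-identityʳ _)))
      H-0 : H 0 ≡ + 1
      H-0 = hilbertSeries-∈ (p^⊥q j) (0 , 0 , refl)

    allOnes : ∀ j → j ≤ k → OnesUpTo j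
    allOnes zero    _     _ ()
    allOnes (suc j) 1+j≤k i i<1+j with m<1+n⇒m<n∨m≡n i<1+j
    ... | inj₁ i<j  = allOnes j (<⇒≤ 1+j≤k) i i<j
    ... | inj₂ refl with e (suc i) in e-1+i
    ...   | true  = refl
    ...   | false = ⊥-elim (no-gap i (allOnes i (<⇒≤ 1+j≤k)) e-1+i 1+j≤k)

    indicator≈hilbertSeries : indicator T ≈ hilbertSeries (p ^ k) q
    indicator≈hilbertSeries =
      ≈-trans (indicator≈ k 0 (allOnes k ≤-refl) (+-identityʳ k)) (⊛-identityʳ (hilbertSeries (p ^ k) q))

    mem⇔∈⟨p^k,q⟩ : ∀ n → (mem T n ≡ true → n ∈⟨ p ^ k , q ⟩) × (n ∈⟨ p ^ k , q ⟩ → mem T n ≡ true)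
    mem⇔∈⟨p^k,q⟩ n =
      (λ n∈T → hilbertSeries≡1⇒∈ (trans (sym (at indicator≈hilbertSeries n)) (cong ind n∈T))) ,
      (λ n∈ → ind≡1⇒true (trans (at indicator≈hilbertSeries n) (hilbertSeries-∈ (p^⊥q k) n∈)))
      where open TwoGenerators (p ^ k) q {{m^n≢0 p k}}

mainTheorem14 : (p q k : ℕ) → Prime p → Prime q → p ≢ q → 1 ≤ k →
    (e : ℕ → Bool) → e k ≡ true →
    (T : NumericalSemigroup) →
    (∀ n → cycloProduct p q e k n ≡ semigroupPoly T n) →
    (∀ i → 1 ≤ i → i ≤ k → e i ≡ true) ×
    (∀ n → (mem T n ≡ true → ∃ λ a → ∃ λ b → n ≡ a * p ^ k + b * q) ×
           ((∃ λ a → ∃ λ b → n ≡ a * p ^ k + b * q) → mem T n ≡ true))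
mainTheorem14 p q k p-prime q-prime p≢q _ e e-k T product≡P_T =
  (λ { (suc i) _ 1+i≤k → allOnes k ≤-refl i 1+i≤k }) , mem⇔∈⟨p^k,q⟩
  where open DistinctPrimes.ProductIsSemigroupPoly p-prime q-prime p≢q e k e-k T (mk≈ product≡P_T)
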